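{- For every $r,b\in\mathbb{N}$, we have $c_{rb}\le c_r\cdot b$.
   Context: Digraphs are finite, have no loops and no parallel arcs (two oppositely oriented arcs between the same pair of vertices are allowed). A digraph is $r$-regular if every vertex has out-degree and in-degree exactly $r$. A collection of openly disjoint directed cycles through a vertex is a collection of directed cycles $C_1,\ldots,C_k$ in $D$ such that some vertex $v$ lies on all of them and the sets $V(C_1)\setminus\{v\},\ldots,V(C_k)\setminus\{v\}$ are pairwise disjoint. $c(D)$ denotes the maximum size of such a collection in $D$, and $c_r$ denotes the minimum of $c(D)$ over all $r$-regular digraphs $D$. -}

module Defs where

open import Data.Nat using (ℕ; _≤_; _*_)
open import Data.Fin using (Fin)
open import Data.Bool using (Bool; true; false)
open import Data.List using (List; []; _∷_; _++_; [_]; length; filterᵇ; allFin)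
open import Data.List.Membership.Propositional using (_∈_)
open import Data.List.Relation.Unary.All using (All)
open import Data.List.Relation.Unary.AllPairs using (AllPairs)
open import Data.List.Relation.Unary.Linked using (Linked)
open import Data.List.Relation.Unary.Unique.Propositional using (Unique)
open import Data.Product using (Σ; ∃; _×_)
open import Relation.Binary.PropositionalEquality using (_≡_)

-- A finite digraph on vertex set Fin order.  The arc relation is Bool-valued,
-- so there are no parallel arcs (but u→w and w→u may both be present);
-- looplessness is an explicit field.
record Digraph : Set where
  field
    order    : ℕ
    arc      : Fin order → Fin order → Bool
    loopless : ∀ v → arc v v ≡ false

open Digraph public

Vertex : Digraph → Set
Vertex D = Fin (order D)

Arc : (D : Digraph) → Vertex D → Vertex D → Set
Arc D u w = arc D u w ≡ true

outdeg : (D : Digraph) → Vertex D → ℕ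
outdeg D v = length (filterᵇ (λ w → arc D v w) (allFin (order D)))

indeg : (D : Digraph) → Vertex D → ℕ
indeg D v = length (filterᵇ (λ u → arc D u v) (allFin (order D)))

Regular : ℕ → Digraph → Set
Regular r D = ∀ v → outdeg D v ≡ r × indeg D v ≡ r

IsCycle : (D : Digraph) → List (Vertex D) → Set
IsCycle D c =
  Σ (Vertex D) λ x → Σ (List (Vertex D)) λ xs →
    (c ≡ x ∷ xs) × Unique c × (2 ≤ length c) × Linked (Arc D) (x ∷ xs ++ [ x ])

OpenlyDisjointThrough : (D : Digraph) → Vertex D → List (List (Vertex D)) → Set
OpenlyDisjointThrough D v cs =
  All (λ c → IsCycle D c × v ∈ c) cs ×
  AllPairs (λ c c′ → ∀ x → x ∈ c → x ∈ c′ → x ≡ v) cs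

Collection : (D : Digraph) → List (List (Vertex D)) → Set
Collection D cs = Σ (Vertex D) λ v → OpenlyDisjointThrough D v cs

-- IsC D k  :  c(D) = k, i.e. k is the maximum size of such a collection.
IsC : Digraph → ℕ → Set
IsC D k = (Σ (List (List (Vertex D))) λ cs → Collection D cs × length cs ≡ k)
        × (∀ cs → Collection D cs → length cs ≤ k)

-- IsCr r m  :  c_r = m, i.e. m is the minimum of c(D) over r-regular D.
IsCr : ℕ → ℕ → Set
IsCr r m = (Σ Digraph λ D → Regular r D × IsC D m)
         × (∀ D → Regular r D → ∀ k → IsC D k → m ≤ k)

-- Take an r-regular D with c(D) = c_r and blow every vertex up into b independent copies.
-- The blow-up D[b] is rb-regular, so c_rb ≤ c(D[b]), and it remains to see c(D[b]) ≤ c(D)·b.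
-- By Menger's theorem in D − v, between the out- and the in-neighbours of v, the number of
-- openly disjoint cycles through v is at least the size of some set S ∌ v meeting every
-- closed walk through v.  A cycle of D[b] through a copy of v projects onto a closed walk of D
-- through v, so the b copies of each vertex of S meet every cycle of D[b] through that copy,
-- and openly disjoint cycles meet them in distinct vertices: c(D[b]) ≤ |S|·b ≤ c(D)·b.
-- For b = 0 the blow-up is empty; instead, a 0-regular digraph has no cycles at all.

module Submission where

open import Data.Bool using (Bool; true; false; T?)
import Data.Bool.Properties as Bool
open import Data.Empty using (⊥; ⊥-elim)
open import Data.Fin using (Fin; zero; suc; _↑ˡ_; _↑ʳ_; quotient; remainder; combine)
open import Data.Fin.Properties using (_≟_; remQuot-combine; combine-remQuot)
open import Data.List
  using (List; []; _∷_; [_]; _++_; length; filter; filterᵇ; map; tabulate; allFin;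
         cartesianProduct; cartesianProductWith; deduplicate)
open import Data.List.Extrema.Nat using (argmax; f[xs]≤f[argmax])
open import Data.List.Membership.Propositional using (_∈_; _∉_; find; lose)
open import Data.List.Membership.Propositional.Properties
  using (∈-filter⁺; ∈-filter⁻; ∈-allFin; ∈-cartesianProduct⁺; ∈-cartesianProductWith⁺;
         ∈-deduplicate⁺; ∈-deduplicate⁻; ∈-∃++; ∈-++⁻; ∈-++⁺ˡ; ∈-++⁺ʳ)
open import Data.List.Properties
  using (filter-notAll; length-map; length-++; length-tabulate; map-++; ++-assoc)
open import Data.List.Relation.Binary.Disjoint.Propositional using (Disjoint)
open import Data.List.Relation.Binary.Subset.Propositional using (_⊆_)
open import Data.List.Relation.Binary.Subset.Propositional.Properties using (Any-resp-⊆)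
open import Data.List.Relation.Unary.All as All using (All; []; _∷_)
import Data.List.Relation.Unary.All.Properties as All
open import Data.List.Relation.Unary.AllPairs as AllPairs using (AllPairs; []; _∷_)
import Data.List.Relation.Unary.AllPairs.Properties as AllPairs
open import Data.List.Relation.Unary.Any as Any using (Any; here; there; any?)
import Data.List.Relation.Unary.Any.Properties as Any
open import Data.List.Relation.Unary.Linked as Linked using (Linked; []; [-]; _∷_)
import Data.List.Relation.Unary.Linked.Properties as Linked
open import Data.List.Relation.Unary.Unique.Propositional using (Unique)
open import Data.Nat using (ℕ; zero; suc; _+_; _*_; _≤_; _<_; z≤n; s≤s; _≤?_)
open import Data.Nat.Properties
  using (≤-trans; ≤-reflexive; <-≤-trans; ≤-<-trans; <⇒≱; ≰⇒>;
         +-assoc; *-distribʳ-+; *-zeroʳ; *-suc; *-monoˡ-≤; module ≤-Reasoning)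
open import Data.Product using (Σ; ∃; ∃-syntax; _×_; _,_; proj₁; proj₂)
open import Data.Sum using (_⊎_; inj₁; inj₂)
open import Data.Unit using (⊤; tt)
open import Function using (_∘_; id; Equivalence)
open import Relation.Binary.Definitions using (DecidableEquality)
open import Relation.Binary.PropositionalEquality
  using (_≡_; _≢_; refl; sym; trans; cong; cong₂; subst; module ≡-Reasoning)
open import Relation.Nullary using (¬_; Dec; yes; no; ¬?)
open import Relation.Nullary.Decidable using (_×-dec_)

open import Defs

module _ {X V : Set} (_≟_ : DecidableEquality V) where

  length≤-distinctWitnesses :
    (R : X → V → Set) (L : List V) (xs : List X) →
    All (λ a → ∃[ y ] y ∈ L × R a y) xs →
    AllPairs (λ a a′ → ∀ {y} → R a y → R a′ y → ⊥) xs →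
    length xs ≤ length L
  length≤-distinctWitnesses R L [] _ _ = z≤n
  length≤-distinctWitnesses R L (a ∷ xs) ((y , y∈L , Ray) ∷ witnesses) (apart ∷ distinct) =
    ≤-trans (s≤s (length≤-distinctWitnesses R L′ xs (All.zipWith shrink (witnesses , apart)) distinct))
            (filter-notAll (λ z → ¬? (z ≟ y)) L (Any.map (λ { refl y≢y → y≢y refl }) y∈L))
    where
    L′ : List V
    L′ = filter (λ z → ¬? (z ≟ y)) L
    shrink : ∀ {b} → (∃[ y′ ] y′ ∈ L × R b y′) × (∀ {y′} → R a y′ → R b y′ → ⊥) →
             ∃[ y′ ] y′ ∈ L′ × R b y′
    shrink ((y′ , y′∈L , Rby′) , apart-ab) =
      y′ , ∈-filter⁺ (λ z → ¬? (z ≟ y)) y′∈L (λ { refl → apart-ab Ray Rby′ }) , Rby′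

module _ {X : Set} {R : X → X → Set} where

  Linked-++-∷⁻ : ∀ xs {m ys} → Linked R (xs ++ m ∷ ys) → Linked R (xs ++ [ m ]) × Linked R (m ∷ ys)
  Linked-++-∷⁻ []           linked       = [-] , linked
  Linked-++-∷⁻ (a ∷ [])     (r ∷ linked) = r ∷ [-] , linked
  Linked-++-∷⁻ (a ∷ b ∷ xs) (r ∷ linked) with Linked-++-∷⁻ (b ∷ xs) linked
  ... | front , back = r ∷ front , back

  Linked-++-∷⁺ : ∀ xs {m ys} → Linked R (xs ++ [ m ]) → Linked R (m ∷ ys) → Linked R (xs ++ m ∷ ys)
  Linked-++-∷⁺ []           _           back = back
  Linked-++-∷⁺ (a ∷ [])     (r ∷ [-])   back = r ∷ back
  Linked-++-∷⁺ (a ∷ b ∷ xs) (r ∷ front) back = r ∷ Linked-++-∷⁺ (b ∷ xs) front back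

  rotate : ∀ {a as x} → Linked R (a ∷ as ++ [ a ]) → x ∈ a ∷ as →
           ∃[ ys ] Linked R (x ∷ ys ++ [ x ]) × ys ⊆ a ∷ as
  rotate {as = as} closed (here refl) = as , closed , there
  rotate {a} {x = x} closed (there x∈as) with ∈-∃++ x∈as
  ... | pre , post , refl = post ++ a ∷ pre , rotated , moved
    where
    halves : Linked R (a ∷ pre ++ [ x ]) × Linked R (x ∷ post ++ [ a ])
    halves = Linked-++-∷⁻ (a ∷ pre)
               (subst (λ zs → Linked R (a ∷ zs)) (++-assoc pre (x ∷ post) [ a ]) closed)
    rotated : Linked R (x ∷ (post ++ a ∷ pre) ++ [ x ])
    rotated = subst (λ zs → Linked R (x ∷ zs)) (sym (++-assoc post (a ∷ pre) [ x ]))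
                    (Linked-++-∷⁺ (x ∷ post) (proj₂ halves) (proj₁ halves))
    moved : post ++ a ∷ pre ⊆ a ∷ pre ++ x ∷ post
    moved t∈ with ∈-++⁻ post t∈
    ... | inj₁ t∈post        = there (∈-++⁺ʳ pre (there t∈post))
    ... | inj₂ (here t≡a)    = here t≡a
    ... | inj₂ (there t∈pre) = there (∈-++⁺ˡ t∈pre)

length-cartesianProductWith : ∀ {A B C : Set} (f : A → B → C) xs ys →
                              length (cartesianProductWith f xs ys) ≡ length xs * length ys
length-cartesianProductWith f []       ys = refl
length-cartesianProductWith f (x ∷ xs) ys = begin
  length (map (f x) ys ++ cartesianProductWith f xs ys)
    ≡⟨ length-++ (map (f x) ys) ⟩
  length (map (f x) ys) + length (cartesianProductWith f xs ys)
    ≡⟨ cong₂ _+_ (length-map (f x) ys) (length-cartesianProductWith f xs ys) ⟩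
  length ys + length xs * length ys
    ∎
  where open ≡-Reasoning

indicator : Bool → ℕ
indicator true  = 1
indicator false = 0

count : ∀ n → (Fin n → Bool) → ℕ
count zero    p = 0
count (suc n) p = indicator (p zero) + count n (p ∘ suc)

length-filterᵇ-tabulate : ∀ {X : Set} n (f : Fin n → X) (p : X → Bool) →
                          length (filterᵇ p (tabulate f)) ≡ count n (p ∘ f)
length-filterᵇ-tabulate zero    f p = refl
length-filterᵇ-tabulate (suc n) f p with p (f zero)
... | true  = cong suc (length-filterᵇ-tabulate n (f ∘ suc) p)
... | false = length-filterᵇ-tabulate n (f ∘ suc) p

count-cong : ∀ n {p q : Fin n → Bool} → (∀ i → p i ≡ q i) → count n p ≡ count n q
count-cong zero    p≗q = refl
count-cong (suc n) p≗q = cong₂ _+_ (cong indicator (p≗q zero)) (count-cong n (p≗q ∘ suc))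

count-+ : ∀ m k (p : Fin (m + k) → Bool) →
          count (m + k) p ≡ count m (p ∘ (_↑ˡ k)) + count k (p ∘ (m ↑ʳ_))
count-+ zero    k p = refl
count-+ (suc m) k p = trans (cong (indicator (p zero) +_) (count-+ m k (p ∘ suc)))
                            (sym (+-assoc (indicator (p zero)) _ _))

count-const : ∀ k c → count k (λ _ → c) ≡ indicator c * k
count-const zero    c = sym (*-zeroʳ (indicator c))
count-const (suc k) c = trans (cong (indicator c +_) (count-const k c)) (sym (*-suc (indicator c) k))

quotient-combine : ∀ {n} b (i : Fin n) (j : Fin b) → quotient {n} b (combine i j) ≡ i
quotient-combine b i j = cong proj₁ (remQuot-combine i j)

quotient-↑ʳ : ∀ {n} b (i : Fin (n * b)) → quotient {suc n} b (b ↑ʳ i) ≡ suc (quotient {n} b i)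
quotient-↑ʳ {n} b i = begin
  quotient {suc n} b (b ↑ʳ i)
    ≡⟨ cong (quotient {suc n} b ∘ (b ↑ʳ_)) (sym (combine-remQuot {n} b i)) ⟩
  quotient {suc n} b (combine (suc (quotient {n} b i)) (remainder {n} b i))
    ≡⟨ quotient-combine b _ _ ⟩
  suc (quotient {n} b i)
    ∎
  where open ≡-Reasoning

count-∘quotient : ∀ n b (p : Fin n → Bool) → count (n * b) (p ∘ quotient {n} b) ≡ count n p * b
count-∘quotient zero    b p = refl
count-∘quotient (suc n) b p = begin
  count (b + n * b) (p ∘ quotient b)
    ≡⟨ count-+ b (n * b) _ ⟩
  count b (p ∘ quotient {suc n} b ∘ (_↑ˡ n * b)) + count (n * b) (p ∘ quotient {suc n} b ∘ (b ↑ʳ_))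
    ≡⟨ cong₂ _+_ (count-cong b (λ j → cong p (quotient-combine b zero j)))
                 (count-cong (n * b) (λ i → cong p (quotient-↑ʳ b i))) ⟩
  count b (λ _ → p zero) + count (n * b) (p ∘ suc ∘ quotient {n} b)
    ≡⟨ cong₂ _+_ (count-const b (p zero)) (count-∘quotient n b (p ∘ suc)) ⟩
  indicator (p zero) * b + count n (p ∘ suc) * b
    ≡⟨ sym (*-distribʳ-+ b (indicator (p zero)) _) ⟩
  count (suc n) p * b
    ∎
  where open ≡-Reasoning

length-filterᵇ-allFin-∘quotient :
  ∀ n b (p : Fin n → Bool) →
  length (filterᵇ (p ∘ quotient b) (allFin (n * b))) ≡ length (filterᵇ p (allFin n)) * b
length-filterᵇ-allFin-∘quotient n b p = begin
  length (filterᵇ (p ∘ quotient b) (allFin (n * b)))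
    ≡⟨ length-filterᵇ-tabulate (n * b) id (p ∘ quotient b) ⟩
  count (n * b) (p ∘ quotient b)
    ≡⟨ count-∘quotient n b p ⟩
  count n p * b
    ≡⟨ cong (_* b) (length-filterᵇ-tabulate n id p) ⟨
  length (filterᵇ p (allFin n)) * b
    ∎
  where open ≡-Reasoning

module Walks {V : Set} where

  private variable
    a b c z : V

  Arcs : Set
  Arcs = List (V × V)

  infixr 5 _∷_ _++ʷ_
  infix 4 _∈ʷ_

  data Walk : V → V → Set where
    stop : (a : V) → Walk a a
    _∷_  : (a : V) {b c : V} → Walk b c → Walk a c

  vertices : Walk a b → List V
  vertices (stop a) = [ a ]
  vertices (a ∷ w)  = a ∷ vertices w

  _∈ʷ_ : V → Walk a b → Set
  z ∈ʷ w = z ∈ vertices w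

  Along : Arcs → Walk a b → Set
  Along E (stop a)      = ⊤
  Along E (_∷_ a {b} w) = (a , b) ∈ E × Along E w

  Along-mono : ∀ {E F} → E ⊆ F → (w : Walk a b) → Along E w → Along F w
  Along-mono E⊆F (stop a) _              = tt
  Along-mono E⊆F (a ∷ w)  (ab∈E , along) = E⊆F ab∈E , Along-mono E⊆F w along

  start∈ʷ : (w : Walk a b) → a ∈ʷ w
  start∈ʷ (stop a) = here refl
  start∈ʷ (a ∷ w)  = here refl

  end∈ʷ : (w : Walk a b) → b ∈ʷ w
  end∈ʷ (stop a) = here refl
  end∈ʷ (a ∷ w)  = there (end∈ʷ w)

  _++ʷ_ : Walk a b → Walk b c → Walk a c
  stop _  ++ʷ q = q
  (a ∷ p) ++ʷ q = a ∷ (p ++ʷ q)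

  ∈-++ʷ⁻ : (p : Walk a b) {q : Walk b c} → z ∈ʷ p ++ʷ q → z ∈ʷ p ⊎ z ∈ʷ q
  ∈-++ʷ⁻ (stop _) z∈q        = inj₂ z∈q
  ∈-++ʷ⁻ (a ∷ p) (here z≡a) = inj₁ (here z≡a)
  ∈-++ʷ⁻ (a ∷ p) (there z∈) with ∈-++ʷ⁻ p z∈
  ... | inj₁ z∈p = inj₁ (there z∈p)
  ... | inj₂ z∈q = inj₂ z∈q

  ∈-++ʷ⁺ˡ : (p : Walk a b) {q : Walk b c} → z ∈ʷ p → z ∈ʷ p ++ʷ q
  ∈-++ʷ⁺ˡ (stop _) {q} (here refl) = start∈ʷ q
  ∈-++ʷ⁺ˡ (a ∷ p) (here z≡a)      = here z≡a
  ∈-++ʷ⁺ˡ (a ∷ p) (there z∈p)     = there (∈-++ʷ⁺ˡ p z∈p)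

  ∈-++ʷ⁺ʳ : (p : Walk a b) {q : Walk b c} → z ∈ʷ q → z ∈ʷ p ++ʷ q
  ∈-++ʷ⁺ʳ (stop _) z∈q = z∈q
  ∈-++ʷ⁺ʳ (a ∷ p) z∈q  = there (∈-++ʷ⁺ʳ p z∈q)

  Along-++ʷ⁺ : ∀ {E} (p : Walk a b) {q : Walk b c} → Along E p → Along E q → Along E (p ++ʷ q)
  Along-++ʷ⁺ (stop _) _                along-q = along-q
  Along-++ʷ⁺ (a ∷ p) (ab∈E , along-p) along-q = ab∈E , Along-++ʷ⁺ p along-p along-q

  Along-++ʷ⁻ : ∀ {E} (p : Walk a b) {q : Walk b c} → Along E (p ++ʷ q) → Along E p × Along E q
  Along-++ʷ⁻ (stop _) along-q = tt , along-q
  Along-++ʷ⁻ (a ∷ p) (ab∈E , along) with Along-++ʷ⁻ p along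
  ... | along-p , along-q = (ab∈E , along-p) , along-q

  Unique-++ʷ⁺ : (p : Walk a b) {q : Walk b c} → Unique (vertices p) → Unique (vertices q) →
                (∀ {z} → z ∈ʷ p → z ∈ʷ q → z ≡ b) → Unique (vertices (p ++ʷ q))
  Unique-++ʷ⁺ (stop _) _ unique-q _ = unique-q
  Unique-++ʷ⁺ (a ∷ p) {q} (a∉p ∷ unique-p) unique-q meet =
    All.tabulate a∉p++q ∷ Unique-++ʷ⁺ p unique-p unique-q (λ z∈p → meet (there z∈p))
    where
    a∉p++q : ∀ {t} → t ∈ʷ p ++ʷ q → a ≢ t
    a∉p++q t∈ refl with ∈-++ʷ⁻ p t∈
    ... | inj₁ a∈p = All.lookup a∉p a∈p refl
    ... | inj₂ a∈q = All.lookup a∉p (subst (_∈ʷ p) (sym (meet (here refl) a∈q)) (end∈ʷ p)) refl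

  Unique-++ʷ⁻-meet : (p : Walk a b) {q : Walk b c} → Unique (vertices (p ++ʷ q)) →
                     z ∈ʷ p → z ∈ʷ q → z ≡ b
  Unique-++ʷ⁻-meet (stop _) _            (here z≡b)  _   = z≡b
  Unique-++ʷ⁻-meet (a ∷ p) (a∉rest ∷ _) (here refl) z∈q =
    ⊥-elim (All.lookup a∉rest (∈-++ʷ⁺ʳ p z∈q) refl)
  Unique-++ʷ⁻-meet (a ∷ p) (_ ∷ unique) (there z∈p) z∈q = Unique-++ʷ⁻-meet p unique z∈p z∈q

  splitAt : (w : Walk a c) → b ∈ʷ w → Σ (Walk a b) λ p → Σ (Walk b c) λ q → w ≡ p ++ʷ q
  splitAt (stop a) (here refl)  = stop a , stop a , refl
  splitAt (a ∷ w)  (here refl)  = stop a , a ∷ w , refl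
  splitAt (a ∷ w)  (there b∈w) with splitAt w b∈w
  ... | p , q , refl = a ∷ p , q , refl

module Menger {V : Set} (_≟_ : DecidableEquality V) where

  open Walks {V}
  open import Data.List.Membership.DecPropositional _≟_ using (_∈?_)
  open import Data.List.Relation.Unary.Unique.DecPropositional.Properties _≟_ using (deduplicate-!)

  private variable
    a b u w z : V
    A B T : List V
    E : Arcs

  record Path (E : Arcs) (A B : List V) : Set where
    field
      start end             : V
      walk                  : Walk start end
      along                 : Along E walk
      start∈                : start ∈ A
      end∈                  : end ∈ B
      unique                : Unique (vertices walk)
      meets-A-only-at-start : ∀ {z} → z ∈ʷ walk → z ∈ A → z ≡ start
      meets-B-only-at-end   : ∀ {z} → z ∈ʷ walk → z ∈ B → z ≡ end
  open Path

  Disjointᴾ : Path E A B → Path E A B → Set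
  Disjointᴾ P Q = Disjoint (vertices (walk P)) (vertices (walk Q))

  Separates : Arcs → List V → List V → List V → Set
  Separates E A B S = ∀ {a b} (w : Walk a b) → Along E w → a ∈ A → b ∈ B → Any (_∈ S) (vertices w)

  record MengerCertificate (E : Arcs) (A B : List V) : Set where
    field
      paths           : List (Path E A B)
      separator       : List V
      paths-disjoint  : AllPairs Disjointᴾ paths
      separates       : Separates E A B separator
      separator≤paths : length separator ≤ length paths
  open MengerCertificate

  length≤-distinctMarks : (Ps : List (Path E A B)) → AllPairs Disjointᴾ Ps →
                          (mark : Path E A B → V) → (∀ P → mark P ∈ʷ walk P) →
                          All (λ P → mark P ∈ T) Ps → length Ps ≤ length T
  length≤-distinctMarks {T = T} Ps Ps-disjoint mark mark∈ marks∈T =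
    length≤-distinctWitnesses _≟_ (λ P t → t ≡ mark P) T Ps
      (All.map (λ {P} m∈T → mark P , m∈T , refl) marks∈T)
      (AllPairs.map (λ {P} {Q} disjoint {t} t≡P t≡Q →
         disjoint (mark∈ P , subst (_∈ʷ walk Q) (trans (sym t≡Q) t≡P) (mark∈ Q)))
       Ps-disjoint)

  shared-vertex⇒≡ : {Ps : List (Path E A B)} → AllPairs Disjointᴾ Ps →
                    ∀ {P Q} → P ∈ Ps → Q ∈ Ps → z ∈ʷ walk P → z ∈ʷ walk Q → P ≡ Q
  shared-vertex⇒≡ _              (here refl) (here refl) _   _   = refl
  shared-vertex⇒≡ (apart ∷ _)    (here refl) (there Q∈)  z∈P z∈Q = ⊥-elim (All.lookup apart Q∈ (z∈P , z∈Q))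
  shared-vertex⇒≡ (apart ∷ _)    (there P∈)  (here refl) z∈P z∈Q = ⊥-elim (All.lookup apart P∈ (z∈Q , z∈P))
  shared-vertex⇒≡ (_ ∷ disjoint) (there P∈)  (there Q∈)  z∈P z∈Q =
    shared-vertex⇒≡ disjoint P∈ Q∈ z∈P z∈Q

  Path-mono : ∀ {F} → E ⊆ F → Path E A B → Path F A B
  Path-mono E⊆F P = record
    { start = start P ; end = end P ; walk = walk P ; along = Along-mono E⊆F (walk P) (along P)
    ; start∈ = start∈ P ; end∈ = end∈ P ; unique = unique P
    ; meets-A-only-at-start = meets-A-only-at-start P ; meets-B-only-at-end = meets-B-only-at-end P }

  trivialPath : z ∈ A → z ∈ B → Path E A B
  trivialPath {z = z} z∈A z∈B = record
    { start = z ; end = z ; walk = stop z ; along = tt ; start∈ = z∈A ; end∈ = z∈B ; unique = [] ∷ []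
    ; meets-A-only-at-start = λ { (here t≡z) _ → t≡z }
    ; meets-B-only-at-end   = λ { (here t≡z) _ → t≡z } }

  trivialPaths : (zs : List V) → All (λ z → z ∈ A × z ∈ B) zs → List (Path E A B)
  trivialPaths []       []                   = []
  trivialPaths (z ∷ zs) ((z∈A , z∈B) ∷ zs∈) = trivialPath z∈A z∈B ∷ trivialPaths zs zs∈

  length-trivialPaths : (zs : List V) (zs∈ : All (λ z → z ∈ A × z ∈ B) zs) →
                        length (trivialPaths {E = E} zs zs∈) ≡ length zs
  length-trivialPaths []       []        = refl
  length-trivialPaths (z ∷ zs) (_ ∷ zs∈) = cong suc (length-trivialPaths zs zs∈)

  trivialPaths-disjoint : (zs : List V) (zs∈ : All (λ z → z ∈ A × z ∈ B) zs) → Unique zs →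
                          AllPairs Disjointᴾ (trivialPaths {E = E} zs zs∈)
  trivialPaths-disjoint []       []        []             = []
  trivialPaths-disjoint {A = A} {B = B} {E = E} (z ∷ zs) ((z∈A , z∈B) ∷ zs∈) (z∉zs ∷ unique) =
    apart zs zs∈ z∉zs ∷ trivialPaths-disjoint zs zs∈ unique
    where
    apart : ∀ ys (ys∈ : All (λ y → y ∈ A × y ∈ B) ys) → All (z ≢_) ys →
            All (Disjointᴾ (trivialPath {E = E} z∈A z∈B)) (trivialPaths ys ys∈)
    apart []       []        []            = []
    apart (y ∷ ys) (_ ∷ ys∈) (z≢y ∷ z∉ys) =
      (λ { (here refl , here refl) → z≢y refl }) ∷ apart ys ys∈ z∉ys

  arcless-certificate : MengerCertificate [] A B
  arcless-certificate {A} {B} = record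
    { paths           = trivialPaths common common⊆
    ; separator       = common
    ; paths-disjoint  = trivialPaths-disjoint common common⊆ (deduplicate-! _)
    ; separates       = common-separates
    ; separator≤paths = ≤-reflexive (sym (length-trivialPaths common common⊆)) }
    where
    common : List V
    common = deduplicate _≟_ (filter (_∈? B) A)
    common⊆ : All (λ z → z ∈ A × z ∈ B) common
    common⊆ = All.tabulate (∈-filter⁻ (_∈? B) ∘ ∈-deduplicate⁻ _≟_ (filter (_∈? B) A))
    common-separates : Separates [] A B common
    common-separates (stop a) _        a∈A a∈B = here (∈-deduplicate⁺ _≟_ (∈-filter⁺ (_∈? B) a∈A a∈B))
    common-separates (a ∷ w)  (() , _)

  -- Adding an arc xy to E, either a separator in E of A from x ∷ S,
  -- or of y ∷ S from B, is no larger than the old family of paths and still separates A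
  -- from B; or both of these problems have more than |S| disjoint paths, and those glue
  -- along S and along xy into |S| + 1 paths from A to B.
  module Extension (x y : V) {E A B} (C : MengerCertificate E A B) where

    S : List V
    S = separator C

    G : Arcs
    G = (x , y) ∷ E

    prefixUntil : (X : List V) → x ∈ X → (w : Walk a b) → Along G w →
                  (∃[ d ] d ∈ X × Σ (Walk a d) λ p → Along E p × vertices p ⊆ vertices w)
                  ⊎ (Along E w × All (_∉ X) (vertices w))
    prefixUntil X x∈X (stop a) _ with a ∈? X
    ... | yes a∈X = inj₁ (a , a∈X , stop a , tt , id)
    ... | no  a∉X = inj₂ (tt , a∉X ∷ [])
    prefixUntil X x∈X (a ∷ w) (ab∈G , along) with a ∈? X
    ... | yes a∈X = inj₁ (a , a∈X , stop a , tt , λ { (here t≡a) → here t≡a })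
    ... | no  a∉X with ab∈G
    ...   | here refl  = ⊥-elim (a∉X x∈X)
    ...   | there ab∈E with prefixUntil X x∈X w along
    ...     | inj₁ (d , d∈X , p , along-p , p⊆w) =
              inj₁ (d , d∈X , a ∷ p , (ab∈E , along-p) ,
                    λ { (here t≡a) → here t≡a ; (there t∈p) → there (p⊆w t∈p) })
    ...     | inj₂ (along-w , w∉X) = inj₂ ((ab∈E , along-w) , a∉X ∷ w∉X)

    suffixFrom : (Y : List V) → y ∈ Y → (w : Walk a b) → Along G w →
                 (∃[ d ] d ∈ Y × Σ (Walk d b) λ q → Along E q × vertices q ⊆ vertices w)
                 ⊎ (Along E w × All (_∉ Y) (vertices w))
    suffixFrom Y y∈Y (stop a) _ with a ∈? Y
    ... | yes a∈Y = inj₁ (a , a∈Y , stop a , tt , id)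
    ... | no  a∉Y = inj₂ (tt , a∉Y ∷ [])
    suffixFrom Y y∈Y (a ∷ w) (ab∈G , along) with suffixFrom Y y∈Y w along
    ... | inj₁ (d , d∈Y , q , along-q , q⊆w) = inj₁ (d , d∈Y , q , along-q , there ∘ q⊆w)
    ... | inj₂ (along-w , w∉Y) with ab∈G
    ...   | here refl  = ⊥-elim (All.lookup w∉Y (start∈ʷ w) y∈Y)
    ...   | there ab∈E with a ∈? Y
    ...     | yes a∈Y = inj₁ (a , a∈Y , a ∷ w , (ab∈E , along-w) , id)
    ...     | no  a∉Y = inj₂ ((ab∈E , along-w) , a∉Y ∷ w∉Y)

    S-unavoidable : ∀ {X} → S ⊆ X → (w : Walk a b) → Along E w → a ∈ A → b ∈ B →
                    All (_∉ X) (vertices w) → ⊥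
    S-unavoidable S⊆X w along a∈A b∈B w∉X with find (separates C w along a∈A b∈B)
    ... | t , t∈w , t∈S = All.lookup w∉X t∈w (S⊆X t∈S)

    separates-through-x : Separates E A (x ∷ S) T → Separates G A B T
    separates-through-x T-separates w along a∈A b∈B with prefixUntil (x ∷ S) (here refl) w along
    ... | inj₁ (d , d∈X , p , along-p , p⊆w) = Any-resp-⊆ p⊆w (T-separates p along-p a∈A d∈X)
    ... | inj₂ (along-w , w∉X) = ⊥-elim (S-unavoidable there w along-w a∈A b∈B w∉X)

    separates-through-y : Separates E (y ∷ S) B T → Separates G A B T
    separates-through-y T-separates w along a∈A b∈B with suffixFrom (y ∷ S) (here refl) w along
    ... | inj₁ (d , d∈Y , q , along-q , q⊆w) = Any-resp-⊆ q⊆w (T-separates q along-q d∈Y b∈B)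
    ... | inj₂ (along-w , w∉Y) = ⊥-elim (S-unavoidable there w along-w a∈A b∈B w∉Y)

    x∷S-separates : Separates G A B (x ∷ S)
    x∷S-separates = separates-through-x (λ w _ _ b∈X → lose (end∈ʷ w) b∈X)

    ReachedFrom : V → Set
    ReachedFrom z = ∃[ a ] Σ (Walk a z) λ p → Along E p × a ∈ A × (∀ {t} → t ∈ʷ p → t ∈ S → t ≡ z)

    Reaching : V → Set
    Reaching z = ∃[ b ] Σ (Walk z b) λ q → Along E q × b ∈ B × (∀ {t} → t ∈ʷ q → t ∈ S → t ≡ z)

    reached-reaching⇒∈S : ReachedFrom z → Reaching z → z ∈ S
    reached-reaching⇒∈S (a , p , along-p , a∈A , p∩S) (b , q , along-q , b∈B , q∩S)
      with find (separates C (p ++ʷ q) (Along-++ʷ⁺ p along-p along-q) a∈A b∈B)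
    ... | t , t∈ , t∈S with ∈-++ʷ⁻ p t∈
    ...   | inj₁ t∈p = subst (_∈ S) (p∩S t∈p t∈S) t∈S
    ...   | inj₂ t∈q = subst (_∈ S) (q∩S t∈q t∈S) t∈S

    reachedFrom-A : z ∈ A → ReachedFrom z
    reachedFrom-A {z} z∈A = z , stop z , tt , z∈A , λ { (here t≡z) _ → t≡z }

    reaching-B : z ∈ B → Reaching z
    reaching-B {z} z∈B = z , stop z , tt , z∈B , λ { (here t≡z) _ → t≡z }

    reachedFrom-prefix : (w : Walk a b) → Along E w → a ∈ A → Unique (vertices w) →
                         (∀ {t} → t ∈ʷ w → t ∈ S → t ≡ b) → z ∈ʷ w → ReachedFrom z
    reachedFrom-prefix {a} w along a∈A unique w∩S z∈w with splitAt w z∈w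
    ... | p , q , refl =
      a , p , proj₁ (Along-++ʷ⁻ p along) , a∈A ,
      λ t∈p t∈S → Unique-++ʷ⁻-meet p unique t∈p
                    (subst (_∈ʷ q) (sym (w∩S (∈-++ʷ⁺ˡ p t∈p) t∈S)) (end∈ʷ q))

    reaching-suffix : (w : Walk a b) → Along E w → b ∈ B → Unique (vertices w) →
                      (∀ {t} → t ∈ʷ w → t ∈ S → t ≡ a) → z ∈ʷ w → Reaching z
    reaching-suffix {b = b} w along b∈B unique w∩S z∈w with splitAt w z∈w
    ... | p , q , refl =
      b , q , proj₂ (Along-++ʷ⁻ p along) , b∈B ,
      λ t∈q t∈S → Unique-++ʷ⁻-meet p unique
                    (subst (_∈ʷ p) (sym (w∩S (∈-++ʷ⁺ʳ p t∈q) t∈S)) (start∈ʷ p)) t∈q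

    module Glue (C₁ : MengerCertificate E A (x ∷ S)) (C₂ : MengerCertificate E (y ∷ S) B)
                (S<Ps₁ : length S < length (paths C₁)) (S<Ps₂ : length S < length (paths C₂)) where

      Ps₁ : List (Path E A (x ∷ S))
      Ps₁ = paths C₁

      Ps₂ : List (Path E (y ∷ S) B)
      Ps₂ = paths C₂

      reachedFrom-on : (P₁ : Path E A (x ∷ S)) → z ∈ʷ walk P₁ → ReachedFrom z
      reachedFrom-on P₁ = reachedFrom-prefix (walk P₁) (along P₁) (start∈ P₁) (unique P₁)
                            (λ t∈ t∈S → meets-B-only-at-end P₁ t∈ (there t∈S))

      reaching-on : (P₂ : Path E (y ∷ S) B) → z ∈ʷ walk P₂ → Reaching z
      reaching-on P₂ = reaching-suffix (walk P₂) (along P₂) (end∈ P₂) (unique P₂)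
                         (λ t∈ t∈S → meets-A-only-at-start P₂ t∈ (there t∈S))

      meet-in-S : (P₁ : Path E A (x ∷ S)) (P₂ : Path E (y ∷ S) B) →
                  z ∈ʷ walk P₁ → z ∈ʷ walk P₂ → z ∈ S
      meet-in-S P₁ P₂ z∈P₁ z∈P₂ = reached-reaching⇒∈S (reachedFrom-on P₁ z∈P₁) (reaching-on P₂ z∈P₂)

      x∉S : x ∉ S
      x∉S x∈S = <⇒≱ S<Ps₁ (length≤-distinctMarks Ps₁ (paths-disjoint C₁) end (end∈ʷ ∘ walk)
                              (All.tabulate (λ {P} _ → into-S (end∈ P))))
        where
        into-S : z ∈ x ∷ S → z ∈ S
        into-S (here refl) = x∈S
        into-S (there z∈S) = z∈S

      y∉S : y ∉ S
      y∉S y∈S = <⇒≱ S<Ps₂ (length≤-distinctMarks Ps₂ (paths-disjoint C₂) start (start∈ʷ ∘ walk)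
                              (All.tabulate (λ {P} _ → into-S (start∈ P))))
        where
        into-S : z ∈ y ∷ S → z ∈ S
        into-S (here refl) = y∈S
        into-S (there z∈S) = z∈S

      ends-cover : ∀ {s} → s ∈ x ∷ S → Any (λ P → end P ≡ s) Ps₁
      ends-cover {s} s∈X with any? (λ P → end P ≟ s) Ps₁
      ... | yes found = found
      ... | no  none  = ⊥-elim (<⇒≱ (<-≤-trans rest<X S<Ps₁) Ps₁≤rest)
        where
        rest : List V
        rest = filter (λ t → ¬? (t ≟ s)) (x ∷ S)
        rest<X : length rest < length (x ∷ S)
        rest<X = filter-notAll (λ t → ¬? (t ≟ s)) (x ∷ S) (Any.map (λ { refl s≢s → s≢s refl }) s∈X)
        Ps₁≤rest : length Ps₁ ≤ length rest
        Ps₁≤rest = length≤-distinctMarks Ps₁ (paths-disjoint C₁) end (end∈ʷ ∘ walk)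
                     (All.map (λ {P} end≢s → ∈-filter⁺ (λ t → ¬? (t ≟ s)) (end∈ P) end≢s)
                              (All.¬Any⇒All¬ Ps₁ none))

      Junction : V → V → Set
      Junction u w = (u ≡ w × w ∈ S) ⊎ (u ≡ x × w ≡ y)

      junction-fromS : Junction u w → u ∈ S → u ≡ w
      junction-fromS (inj₁ (u≡w , _))  _   = u≡w
      junction-fromS (inj₂ (refl , _)) x∈S = ⊥-elim (x∉S x∈S)

      junction-intoS : Junction u w → w ∈ S → u ≡ w
      junction-intoS (inj₁ (u≡w , _))  _   = u≡w
      junction-intoS (inj₂ (_ , refl)) y∈S = ⊥-elim (y∉S y∈S)

      junction-functional : ∀ {w′} → Junction u w → Junction u w′ → w ≡ w′
      junction-functional (inj₁ (refl , _))   (inj₁ (refl , _))   = refl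
      junction-functional (inj₁ (refl , w∈S)) (inj₂ (refl , _))   = ⊥-elim (x∉S w∈S)
      junction-functional (inj₂ (refl , _))   (inj₁ (refl , w∈S)) = ⊥-elim (x∉S w∈S)
      junction-functional (inj₂ (_ , refl))   (inj₂ (_ , refl))   = refl

      bridge : Walk a u → Junction u w → Walk w b → Walk a b
      bridge p (inj₁ (refl , _))    q = p ++ʷ q
      bridge p (inj₂ (refl , refl)) q = p ++ʷ (x ∷ q)

      ∈-bridge⁻ : (p : Walk a u) (j : Junction u w) (q : Walk w b) → z ∈ʷ bridge p j q → z ∈ʷ p ⊎ z ∈ʷ q
      ∈-bridge⁻ p (inj₁ (refl , _))    q z∈ = ∈-++ʷ⁻ p z∈
      ∈-bridge⁻ p (inj₂ (refl , refl)) q z∈ with ∈-++ʷ⁻ p z∈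
      ... | inj₁ z∈p         = inj₁ z∈p
      ... | inj₂ (here refl) = inj₁ (end∈ʷ p)
      ... | inj₂ (there z∈q) = inj₂ z∈q

      Along-bridge : (p : Walk a u) (j : Junction u w) (q : Walk w b) →
                     Along E p → Along E q → Along G (bridge p j q)
      Along-bridge p (inj₁ (refl , _)) q along-p along-q =
        Along-++ʷ⁺ p (Along-mono there p along-p) (Along-mono there q along-q)
      Along-bridge p (inj₂ (refl , refl)) q along-p along-q =
        Along-++ʷ⁺ p (Along-mono there p along-p) (here refl , Along-mono there q along-q)

      Unique-bridge : (p : Walk a u) (j : Junction u w) (q : Walk w b) →
                      Unique (vertices p) → Unique (vertices q) →
                      (∀ {t} → t ∈ʷ p → t ∈ʷ q → t ∈ S) → (∀ {t} → t ∈ʷ p → t ∈ S → t ≡ u) →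
                      Unique (vertices (bridge p j q))
      Unique-bridge p (inj₁ (refl , _)) q unique-p unique-q shared∈S p∩S =
        Unique-++ʷ⁺ p unique-p unique-q (λ t∈p t∈q → p∩S t∈p (shared∈S t∈p t∈q))
      Unique-bridge p (inj₂ (refl , refl)) q unique-p unique-q shared∈S p∩S =
        Unique-++ʷ⁺ p unique-p (All.tabulate x∉q ∷ unique-q) meet
        where
        x∉q : ∀ {t} → t ∈ʷ q → x ≢ t
        x∉q x∈q refl = x∉S (shared∈S (end∈ʷ p) x∈q)
        meet : ∀ {t} → t ∈ʷ p → t ∈ʷ x ∷ q → t ≡ x
        meet _   (here t≡x)  = t≡x
        meet t∈p (there t∈q) = p∩S t∈p (shared∈S t∈p t∈q)

      glue : (P₁ : Path E A (x ∷ S)) (P₂ : Path E (y ∷ S) B) → Junction (end P₁) (start P₂) → Path G A B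
      glue P₁ P₂ j = record
        { start = start P₁ ; end = end P₂ ; walk = bridge (walk P₁) j (walk P₂)
        ; along = Along-bridge (walk P₁) j (walk P₂) (along P₁) (along P₂)
        ; start∈ = start∈ P₁ ; end∈ = end∈ P₂
        ; unique = Unique-bridge (walk P₁) j (walk P₂) (unique P₁) (unique P₂) (meet-in-S P₁ P₂)
                     (λ t∈ t∈S → meets-B-only-at-end P₁ t∈ (there t∈S))
        ; meets-A-only-at-start = meets-A ∘ ∈-bridge⁻ (walk P₁) j (walk P₂)
        ; meets-B-only-at-end   = meets-B ∘ ∈-bridge⁻ (walk P₁) j (walk P₂) }
        where
        meets-A : z ∈ʷ walk P₁ ⊎ z ∈ʷ walk P₂ → z ∈ A → z ≡ start P₁
        meets-A (inj₁ z∈P₁) z∈A = meets-A-only-at-start P₁ z∈P₁ z∈A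
        meets-A {z} (inj₂ z∈P₂) z∈A =
          meets-A-only-at-start P₁ (subst (_∈ʷ walk P₁) end₁≡z (end∈ʷ (walk P₁))) z∈A
          where
          z∈S : z ∈ S
          z∈S = reached-reaching⇒∈S (reachedFrom-A z∈A) (reaching-on P₂ z∈P₂)
          z≡start₂ : z ≡ start P₂
          z≡start₂ = meets-A-only-at-start P₂ z∈P₂ (there z∈S)
          end₁≡z : end P₁ ≡ z
          end₁≡z = trans (junction-intoS j (subst (_∈ S) z≡start₂ z∈S)) (sym z≡start₂)
        meets-B : z ∈ʷ walk P₁ ⊎ z ∈ʷ walk P₂ → z ∈ B → z ≡ end P₂
        meets-B (inj₂ z∈P₂) z∈B = meets-B-only-at-end P₂ z∈P₂ z∈B
        meets-B {z} (inj₁ z∈P₁) z∈B =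
          meets-B-only-at-end P₂ (subst (_∈ʷ walk P₂) start₂≡z (start∈ʷ (walk P₂))) z∈B
          where
          z∈S : z ∈ S
          z∈S = reached-reaching⇒∈S (reachedFrom-on P₁ z∈P₁) (reaching-B z∈B)
          z≡end₁ : z ≡ end P₁
          z≡end₁ = meets-B-only-at-end P₁ z∈P₁ (there z∈S)
          start₂≡z : start P₂ ≡ z
          start₂≡z = sym (trans z≡end₁ (junction-fromS j (subst (_∈ S) z≡end₁ z∈S)))

      Partner : Path E (y ∷ S) B → Set
      Partner P₂ = ∃[ P₁ ] P₁ ∈ Ps₁ × Junction (end P₁) (start P₂)

      partner : ∀ P₂ → Partner P₂
      partner P₂ with start∈ P₂
      ... | here start≡y with find (ends-cover (here refl))
      ...   | P₁ , P₁∈ , end≡x = P₁ , P₁∈ , inj₂ (end≡x , start≡y)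
      partner P₂ | there start∈S with find (ends-cover (there start∈S))
      ...   | P₁ , P₁∈ , end≡start = P₁ , P₁∈ , inj₁ (end≡start , start∈S)

      glueWith : ∀ P₂ → Partner P₂ → Path G A B
      glueWith P₂ (P₁ , _ , j) = glue P₁ P₂ j

      meeting⇒same-start : (P₁ : Path E A (x ∷ S)) (P₂ Q₂ : Path E (y ∷ S) B) →
                           Junction (end P₁) (start P₂) → z ∈ʷ walk P₁ → z ∈ʷ walk Q₂ →
                           start P₂ ≡ start Q₂
      meeting⇒same-start {z} P₁ P₂ Q₂ j z∈P₁ z∈Q₂ =
        trans (sym (junction-fromS j (subst (_∈ S) z≡end₁ z∈S)))
              (trans (sym z≡end₁) (meets-A-only-at-start Q₂ z∈Q₂ (there z∈S)))
        where
        z∈S : z ∈ S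
        z∈S = meet-in-S P₁ Q₂ z∈P₁ z∈Q₂
        z≡end₁ : z ≡ end P₁
        z≡end₁ = meets-B-only-at-end P₁ z∈P₁ (there z∈S)

      glueWith-disjoint : ∀ {P₂ Q₂} (π : Partner P₂) (ρ : Partner Q₂) →
                          Disjointᴾ P₂ Q₂ → Disjointᴾ (glueWith P₂ π) (glueWith Q₂ ρ)
      glueWith-disjoint {P₂} {Q₂} (P₁ , P₁∈ , j) (Q₁ , Q₁∈ , k) disjoint {z} (z∈P , z∈Q) =
        on-both (∈-bridge⁻ (walk P₁) j (walk P₂) z∈P) (∈-bridge⁻ (walk Q₁) k (walk Q₂) z∈Q)
        where
        distinct-starts : start P₂ ≢ start Q₂
        distinct-starts e = disjoint (start∈ʷ (walk P₂) , subst (_∈ʷ walk Q₂) (sym e) (start∈ʷ (walk Q₂)))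
        on-both : z ∈ʷ walk P₁ ⊎ z ∈ʷ walk P₂ → z ∈ʷ walk Q₁ ⊎ z ∈ʷ walk Q₂ → ⊥
        on-both (inj₂ z∈P₂) (inj₂ z∈Q₂) = disjoint (z∈P₂ , z∈Q₂)
        on-both (inj₁ z∈P₁) (inj₂ z∈Q₂) = distinct-starts (meeting⇒same-start P₁ P₂ Q₂ j z∈P₁ z∈Q₂)
        on-both (inj₂ z∈P₂) (inj₁ z∈Q₁) = distinct-starts (sym (meeting⇒same-start Q₁ Q₂ P₂ k z∈Q₁ z∈P₂))
        on-both (inj₁ z∈P₁) (inj₁ z∈Q₁)
          with shared-vertex⇒≡ (paths-disjoint C₁) P₁∈ Q₁∈ z∈P₁ z∈Q₁
        ... | refl = distinct-starts (junction-functional j k)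

      glued : Path E (y ∷ S) B → Path G A B
      glued P₂ = glueWith P₂ (partner P₂)

      certificate : MengerCertificate G A B
      certificate = record
        { paths           = map glued Ps₂
        ; separator       = x ∷ S
        ; paths-disjoint  = AllPairs.map⁺ (AllPairs.map (λ {P₂} {Q₂} → glueWith-disjoint {P₂} {Q₂}
                                                                         (partner P₂) (partner Q₂))
                                                        (paths-disjoint C₂))
        ; separates       = x∷S-separates
        ; separator≤paths = ≤-trans S<Ps₂ (≤-reflexive (sym (length-map glued Ps₂))) }

    reusing : Separates G A B T → length T ≤ length (paths C) → MengerCertificate G A B
    reusing {T} T-separates T≤Ps = record
      { paths           = map (Path-mono there) (paths C)
      ; separator       = T
      ; paths-disjoint  = AllPairs.map⁺ (AllPairs.map id (paths-disjoint C))
      ; separates       = T-separates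
      ; separator≤paths = ≤-trans T≤Ps (≤-reflexive (sym (length-map (Path-mono there) (paths C)))) }

    extend : MengerCertificate E A (x ∷ S) → MengerCertificate E (y ∷ S) B → MengerCertificate G A B
    extend C₁ C₂
      with length (separator C₁) ≤? length (paths C) | length (separator C₂) ≤? length (paths C)
    ... | yes T₁≤Ps | _         = reusing (separates-through-x (separates C₁)) T₁≤Ps
    ... | no _      | yes T₂≤Ps = reusing (separates-through-y (separates C₂)) T₂≤Ps
    ... | no T₁≰Ps  | no T₂≰Ps  =
      Glue.certificate C₁ C₂ (S<paths (separator C₁) T₁≰Ps (separator≤paths C₁))
                             (S<paths (separator C₂) T₂≰Ps (separator≤paths C₂))
      where
      S<paths : ∀ T {n} → ¬ length T ≤ length (paths C) → length T ≤ n → length S < n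
      S<paths T T≰Ps T≤n = <-≤-trans (≤-<-trans (separator≤paths C) (≰⇒> T≰Ps)) T≤n

  menger : ∀ E A B → MengerCertificate E A B
  menger []            A B = arcless-certificate
  menger ((x , y) ∷ E) A B = Extension.extend x y C (menger E A (x ∷ S)) (menger E (y ∷ S) B)
    where
    C : MengerCertificate E A B
    C = menger E A B
    S : List V
    S = separator C

arc? : (D : Digraph) (u w : Vertex D) → Dec (Arc D u w)
arc? D u w = arc D u w Bool.≟ true

¬loop : (D : Digraph) (v : Vertex D) → ¬ Arc D v v
¬loop D v v→v with trans (sym v→v) (loopless D v)
... | ()

-- Closed walks rather than cycles: a cycle of the blow-up projects only onto a closed walk.
ClosedWalkCut : (D : Digraph) → Vertex D → List (Vertex D) → Set
ClosedWalkCut D v S = ∀ ws → Linked (Arc D) (v ∷ ws ++ [ v ]) → Any (λ z → z ≢ v × z ∈ S) ws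

record LocalMenger (D : Digraph) (v : Vertex D) : Set where
  field
    cycles                : List (List (Vertex D))
    cut                   : List (Vertex D)
    cycles-openlyDisjoint : OpenlyDisjointThrough D v cycles
    cut-meets             : ClosedWalkCut D v cut
    cut≤cycles            : length cut ≤ length cycles

module LocalMengerConstruction (D : Digraph) (v : Vertex D) where

  open Walks {Vertex D}
  open Menger (_≟_ {order D})
  open Path
  open MengerCertificate

  private variable
    a b : Vertex D

  avoids-v? : (e : Vertex D × Vertex D) → Dec (Arc D (proj₁ e) (proj₂ e) × proj₁ e ≢ v × proj₂ e ≢ v)
  avoids-v? (a , b) = arc? D a b ×-dec ¬? (a ≟ v) ×-dec ¬? (b ≟ v)

  allPairs : List (Vertex D × Vertex D)
  allPairs = cartesianProduct (allFin (order D)) (allFin (order D))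

  E : Arcs
  E = filter avoids-v? allPairs

  out in′ : List (Vertex D)
  out = filter (arc? D v) (allFin (order D))
  in′ = filter (λ a → arc? D a v) (allFin (order D))

  out-sound : b ∈ out → Arc D v b
  out-sound = proj₂ ∘ ∈-filter⁻ (arc? D v) {xs = allFin (order D)}

  out-complete : Arc D v b → b ∈ out
  out-complete {b} = ∈-filter⁺ (arc? D v) (∈-allFin b)

  in-sound : a ∈ in′ → Arc D a v
  in-sound = proj₂ ∘ ∈-filter⁻ (λ a → arc? D a v) {xs = allFin (order D)}

  in-complete : Arc D a v → a ∈ in′
  in-complete {a} = ∈-filter⁺ (λ a → arc? D a v) (∈-allFin a)

  E-sound : (a , b) ∈ E → Arc D a b × a ≢ v × b ≢ v
  E-sound = proj₂ ∘ ∈-filter⁻ avoids-v? {xs = allPairs}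

  E-complete : Arc D a b → a ≢ v → b ≢ v → (a , b) ∈ E
  E-complete {a} {b} a→b a≢v b≢v =
    ∈-filter⁺ avoids-v? (∈-cartesianProduct⁺ (∈-allFin a) (∈-allFin b)) (a→b , a≢v , b≢v)

  walk-avoids-v : (w : Walk a b) → Along E w → a ≢ v → All (_≢ v) (vertices w)
  walk-avoids-v (stop a) _              a≢v = a≢v ∷ []
  walk-avoids-v (a ∷ w)  (ab∈E , along) a≢v = a≢v ∷ walk-avoids-v w along (proj₂ (proj₂ (E-sound ab∈E)))

  closing-Linked : (w : Walk a b) → Along E w → Arc D b v → Linked (Arc D) (vertices w ++ [ v ])
  closing-Linked (stop a)     _              b→v = b→v ∷ [-]
  closing-Linked (a ∷ stop b) (ab∈E , _)     b→v = proj₁ (E-sound ab∈E) ∷ b→v ∷ [-]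
  closing-Linked (a ∷ b ∷ w)  (ab∈E , along) b→v = proj₁ (E-sound ab∈E) ∷ closing-Linked (b ∷ w) along b→v

  closed-Linked : (w : Walk a b) → Along E w → Arc D v a → Arc D b v →
                  Linked (Arc D) (v ∷ vertices w ++ [ v ])
  closed-Linked (stop a) along v→a b→v = v→a ∷ closing-Linked (stop a) along b→v
  closed-Linked (a ∷ w)  along v→a b→v = v→a ∷ closing-Linked (a ∷ w) along b→v

  cycleOf : Path E out in′ → List (Vertex D)
  cycleOf P = v ∷ vertices (walk P)

  cycleOf-isCycle : (P : Path E out in′) → IsCycle D (cycleOf P)
  cycleOf-isCycle P =
    v , vertices (walk P) , refl ,
    All.map (λ t≢v v≡t → t≢v (sym v≡t)) (walk-avoids-v (walk P) (along P) start≢v) ∷ unique P ,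
    s≤s (length-vertices (walk P)) ,
    closed-Linked (walk P) (along P) v→start (in-sound (end∈ P))
    where
    v→start : Arc D v (start P)
    v→start = out-sound (start∈ P)
    start≢v : start P ≢ v
    start≢v refl = ¬loop D v v→start
    length-vertices : (w : Walk a b) → 1 ≤ length (vertices w)
    length-vertices (stop a) = s≤s z≤n
    length-vertices (a ∷ w)  = s≤s z≤n

  cycleOf-openlyDisjoint : (P Q : Path E out in′) → Disjointᴾ P Q →
                           ∀ z → z ∈ cycleOf P → z ∈ cycleOf Q → z ≡ v
  cycleOf-openlyDisjoint P Q _        z (here z≡v)  _           = z≡v
  cycleOf-openlyDisjoint P Q _        z (there _)   (here z≡v)  = z≡v
  cycleOf-openlyDisjoint P Q disjoint z (there z∈P) (there z∈Q) = ⊥-elim (disjoint (z∈P , z∈Q))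

  ReturnWalk : Vertex D → List (Vertex D) → Set
  ReturnWalk c l = ∃[ b ] Σ (Walk c b) λ w → Along E w × b ∈ in′ × vertices w ⊆ c ∷ l

  returnWalk : ∀ c l → c ≢ v → Linked (Arc D) (c ∷ l ++ [ v ]) → ReturnWalk c l
  returnWalk c []      _   (c→v ∷ [-]) = c , stop c , tt , in-complete c→v , id
  returnWalk c (d ∷ l) c≢v (c→d ∷ rest) with d ≟ v
  ... | yes refl = c , stop c , tt , in-complete c→d , λ { (here t≡c) → here t≡c }
  ... | no  d≢v with returnWalk d l d≢v rest
  ...   | b , w , along , b∈in , w⊆ =
          b , c ∷ w , (E-complete c→d c≢v d≢v , along) , b∈in ,
          λ { (here t≡c) → here t≡c ; (there t∈w) → there (w⊆ t∈w) }

  certificate : MengerCertificate E out in′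
  certificate = menger E out in′

  separator-cuts : ClosedWalkCut D v (separator certificate)
  separator-cuts []      (v→v ∷ [-])  = ⊥-elim (¬loop D v v→v)
  separator-cuts (d ∷ l) (v→d ∷ rest) = meets (returnWalk d l d≢v rest)
    where
    d≢v : d ≢ v
    d≢v refl = ¬loop D v v→d
    meets : ReturnWalk d l → Any (λ z → z ≢ v × z ∈ separator certificate) (d ∷ l)
    meets (b , w , along , b∈in , w⊆) with find (separates certificate w along (out-complete v→d) b∈in)
    ... | z , z∈w , z∈S = lose (w⊆ z∈w) (All.lookup (walk-avoids-v w along d≢v) z∈w , z∈S)

  localMenger : LocalMenger D v
  localMenger = record
    { cycles                = map cycleOf (paths certificate)
    ; cut                   = separator certificate
    ; cycles-openlyDisjoint =
        All.map⁺ (All.tabulate (λ {P} _ → cycleOf-isCycle P , here refl)) ,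
        AllPairs.map⁺ (AllPairs.map (λ {P} {Q} → cycleOf-openlyDisjoint P Q) (paths-disjoint certificate))
    ; cut-meets             = separator-cuts
    ; cut≤cycles            = ≤-trans (separator≤paths certificate)
                                      (≤-reflexive (sym (length-map cycleOf (paths certificate)))) }

cut-meets-cycle : {D D′ : Digraph} (f : Vertex D′ → Vertex D) →
                  (∀ {u w} → Arc D′ u w → Arc D (f u) (f w)) →
                  ∀ {x S c} → ClosedWalkCut D (f x) S → IsCycle D′ c → x ∈ c →
                  Any (λ y → y ≢ x × f y ∈ S) c
cut-meets-cycle {D} f f-arc {x} cut (a , as , refl , _ , _ , closed) x∈c with rotate closed x∈c
... | ys , closed′ , ys⊆c =
  Any-resp-⊆ ys⊆c (Any.map (λ (fy≢fx , fy∈S) → fy≢fx ∘ cong f , fy∈S)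
                           (Any.map⁻ (cut (map f ys) closedᶠ)))
  where
  closedᶠ : Linked (Arc D) (f x ∷ map f ys ++ [ f x ])
  closedᶠ = subst (λ zs → Linked (Arc D) (f x ∷ zs)) (map-++ f ys [ x ])
                  (Linked.map⁺ (Linked.map f-arc closed′))

openlyDisjoint-length≤ : {D : Digraph} {x : Vertex D} {cs : List (List (Vertex D))} {T : List (Vertex D)} →
                         OpenlyDisjointThrough D x cs → All (Any (λ z → z ≢ x × z ∈ T)) cs →
                         length cs ≤ length T
openlyDisjoint-length≤ {x = x} {cs} {T} (_ , disjoint) meets =
  length≤-distinctWitnesses _≟_ (λ c z → z ∈ c × z ≢ x) T cs
    (All.map witness meets)
    (AllPairs.map (λ share {z} (z∈c , z≢x) (z∈c′ , _) → z≢x (share z z∈c z∈c′)) disjoint)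
  where
  witness : ∀ {c} → Any (λ z → z ≢ x × z ∈ T) c → ∃[ z ] z ∈ T × z ∈ c × z ≢ x
  witness meet with find meet
  ... | z , z∈c , z≢x , z∈T = z , z∈T , z∈c , z≢x

collection≤cut : {D : Digraph} {x : Vertex D} {cs : List (List (Vertex D))} {S : List (Vertex D)} →
                 OpenlyDisjointThrough D x cs → ClosedWalkCut D x S → length cs ≤ length S
collection≤cut {D} {S = S} od@(cycles , _) cut =
  openlyDisjoint-length≤ {D} {T = S} od
    (All.map (λ (isCycle , x∈c) → cut-meets-cycle {D} {D} id id cut isCycle x∈c) cycles)

IsC-exists : (D : Digraph) → Vertex D → ∃ (IsC D)
IsC-exists D v = μ best , (cycles (M best) , (best , cycles-openlyDisjoint (M best)) , refl) , maximal
  where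
  open LocalMenger
  M : (x : Vertex D) → LocalMenger D x
  M = LocalMengerConstruction.localMenger D
  μ : Vertex D → ℕ
  μ x = length (cycles (M x))
  best : Vertex D
  best = argmax μ v (allFin (order D))
  maximal : ∀ cs → Collection D cs → length cs ≤ μ best
  maximal cs (x , od) =
    ≤-trans (collection≤cut {D} od (cut-meets (M x)))
            (≤-trans (cut≤cycles (M x))
                     (All.lookup (f[xs]≤f[argmax] v (allFin (order D))) (∈-allFin x)))

blowUp : Digraph → ℕ → Digraph
blowUp D b = record
  { order    = order D * b
  ; arc      = λ u w → arc D (quotient b u) (quotient b w)
  ; loopless = λ u → loopless D (quotient b u) }

blowUp-regular : ∀ {r} D b → Regular r D → Regular (r * b) (blowUp D b)
blowUp-regular D b regular y =
  trans (length-filterᵇ-allFin-∘quotient (order D) b (arc D (quotient b y)))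
        (cong (_* b) (proj₁ (regular (quotient b y)))) ,
  trans (length-filterᵇ-allFin-∘quotient (order D) b (λ u → arc D u (quotient b y)))
        (cong (_* b) (proj₂ (regular (quotient b y))))

copies : ∀ {n} b → List (Fin n) → List (Fin (n * b))
copies b S = cartesianProductWith combine S (allFin b)

∈-copies : ∀ {n} b {S : List (Fin n)} {y} → quotient b y ∈ S → y ∈ copies b S
∈-copies {n} b {S} {y} q∈S =
  subst (_∈ copies b S) (combine-remQuot {n} b y)
        (∈-cartesianProductWith⁺ combine q∈S (∈-allFin (remainder {n} b y)))

length-copies : ∀ {n} b (S : List (Fin n)) → length (copies b S) ≡ length S * b
length-copies b S =
  trans (length-cartesianProductWith combine S (allFin b)) (cong (length S *_) (length-tabulate id))

blowUp-collection≤ : (D : Digraph) (b : ℕ) {x : Vertex (blowUp D b)} {cs : List (List (Vertex (blowUp D b)))}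
                     {S : List (Vertex D)} → OpenlyDisjointThrough (blowUp D b) x cs →
                     ClosedWalkCut D (quotient b x) S → length cs ≤ length S * b
blowUp-collection≤ D b {x} {S = S} od@(cycles , _) cut =
  ≤-trans (openlyDisjoint-length≤ {blowUp D b} {T = copies b S} od (All.map meets cycles))
          (≤-reflexive (length-copies b S))
  where
  meets : ∀ {c} → IsCycle (blowUp D b) c × x ∈ c → Any (λ y → y ≢ x × y ∈ copies b S) c
  meets (isCycle , x∈c) = Any.map (λ (y≢x , qy∈S) → y≢x , ∈-copies b qy∈S)
                                  (cut-meets-cycle {D} {blowUp D b} (quotient b) id cut isCycle x∈c)

IsC-blowUp≤ : ∀ {c k} D b → IsC D c → IsC (blowUp D b) k → k ≤ c * b
IsC-blowUp≤ D b (_ , c-maximal) ((cs , (x , od) , refl) , _) =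
  ≤-trans (blowUp-collection≤ D b od (cut-meets M))
          (*-monoˡ-≤ b (≤-trans (cut≤cycles M)
                                (c-maximal (cycles M) (quotient b x , cycles-openlyDisjoint M))))
  where
  open LocalMenger
  M : LocalMenger D (quotient b x)
  M = LocalMengerConstruction.localMenger D (quotient b x)

arc⇒0<outdeg : (D : Digraph) {u w : Vertex D} → Arc D u w → 0 < outdeg D u
arc⇒0<outdeg D {u} {w} u→w =
  nonempty (∈-filter⁺ (T? ∘ arc D u) (∈-allFin w) (Equivalence.from Bool.T-≡ u→w))
  where
  nonempty : ∀ {xs : List (Vertex D)} → w ∈ xs → 0 < length xs
  nonempty (here _)  = s≤s z≤n
  nonempty (there _) = s≤s z≤n

cycle-arc : {D : Digraph} {c : List (Vertex D)} → IsCycle D c → ∃[ u ] ∃[ w ] Arc D u w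
cycle-arc (u , []    , _ , _ , _ , u→u ∷ [-]) = u , u , u→u
cycle-arc (u , w ∷ _ , _ , _ , _ , u→w ∷ _)   = u , w , u→w

IsC-0-regular : ∀ {k} D → Regular 0 D → IsC D k → k ≡ 0
IsC-0-regular D regular (([]    , _ , length≡k) , _) = sym length≡k
IsC-0-regular D regular ((_ ∷ _ , (_ , (isCycle , _) ∷ _ , _) , _) , _) with cycle-arc {D} isCycle
... | u , w , u→w with subst (0 <_) (proj₁ (regular u)) (arc⇒0<outdeg D u→w)
...   | ()

proposition1p10 : ∀ (r b cr crb : ℕ) → IsCr r cr → IsCr (r * b) crb → crb ≤ cr * b
proposition1p10 r zero cr crb _ ((D₀ , D₀-regular , c[D₀]) , _) = begin
  crb      ≡⟨ IsC-0-regular D₀ (subst (λ d → Regular d D₀) (*-zeroʳ r) D₀-regular) c[D₀] ⟩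
  0        ≡⟨ *-zeroʳ cr ⟨
  cr * 0   ∎
  where open ≤-Reasoning
proposition1p10 r b@(suc _) cr crb ((D , D-regular , c[D]@((_ , (v , _) , _) , _)) , _) (_ , crb-minimal) =
  begin
  crb      ≤⟨ crb-minimal (blowUp D b) (blowUp-regular D b D-regular) k c[D[b]] ⟩
  k        ≤⟨ IsC-blowUp≤ D b c[D] c[D[b]] ⟩
  cr * b   ∎
  where
  open ≤-Reasoning
  k : ℕ
  k = proj₁ (IsC-exists (blowUp D b) (combine v zero))
  c[D[b]] : IsC (blowUp D b) k
  c[D[b]] = proj₂ (IsC-exists (blowUp D b) (combine v zero))
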